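{- Let $G$ be a graph and let $u$ be a vertex of degree $2$ in $G$ whose neighbours $v_1,v_2$ satisfy $v_1v_2\notin E(G)$. Then $\operatorname{pw}(G)\le \operatorname{pw}(G/uv_1/uv_2)+1$.
   Context: $\operatorname{pw}$ denotes path-width and $G/xy$ denotes the graph obtained from $G$ by contracting the edge $xy$ (removing $y$ and joining $x$ to every former neighbour of $y$ other than $x$). -}

module Defs where

open import Data.Nat using (ℕ; suc; _≤_)
open import Data.Bool using (Bool; true; false; _∧_; _∨_; not)
open import Data.Fin using (Fin) renaming (_≤_ to _≤ᶠ_)
open import Data.Fin.Properties using (_≟_)
open import Data.List using (List; length; lookup)
open import Data.List.Membership.Propositional using (_∈_)
open import Data.List.Relation.Unary.All using (All)
open import Data.List.Relation.Unary.Any using (Any)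
open import Data.List.Relation.Unary.Unique.Propositional using (Unique)
open import Data.Empty using (⊥)
open import Data.Sum using (_⊎_)
open import Data.Product using (Σ; _×_; ∃)
open import Relation.Binary.PropositionalEquality using (_≡_)
open import Relation.Nullary.Decidable using (⌊_⌋)

record Graph (n : ℕ) : Set where
  constructor mkGraph
  field
    vert : Fin n → Bool
    adj  : Fin n → Fin n → Bool
open Graph public

record Simple {n : ℕ} (G : Graph n) : Set where
  field
    adj-sym    : ∀ a b → adj G a b ≡ true → adj G b a ≡ true
    adj-irrefl : ∀ a → adj G a a ≡ false
    adj-vertˡ  : ∀ a b → adj G a b ≡ true → vert G a ≡ true

_==_ : {n : ℕ} → Fin n → Fin n → Bool
a == b = ⌊ a ≟ b ⌋

-- G / xy : delete y, and join x to every former neighbour of y other than x.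
_/_─_ : {n : ℕ} → Graph n → Fin n → Fin n → Graph n
vert (G / x ─ y) w = vert G w ∧ not (w == y)
adj  (G / x ─ y) a b =
  not (a == y) ∧ not (b == y) ∧ not (a == b) ∧
  (adj G a b ∨ ((a == x) ∧ adj G y b) ∨ ((b == x) ∧ adj G y a))

record PathDecomposition {n : ℕ} (G : Graph n) : Set where
  field
    bags        : List (List (Fin n))
    bags-unique : All Unique bags
    bags-vert   : All (All (λ v → vert G v ≡ true)) bags
    cover-vert  : ∀ v → vert G v ≡ true → Any (v ∈_) bags
    cover-edge  : ∀ a b → adj G a b ≡ true → Any (λ B → a ∈ B × b ∈ B) bags
    contiguous  : ∀ (i j k : Fin (length bags)) (v : Fin n) →
                  i ≤ᶠ j → j ≤ᶠ k →
                  v ∈ lookup bags i → v ∈ lookup bags k → v ∈ lookup bags j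
open PathDecomposition public

WidthAtMost : {n : ℕ} {G : Graph n} → PathDecomposition G → ℕ → Set
WidthAtMost D k = All (λ B → length B ≤ suc k) (bags D)

PathWidthAtMost : {n : ℕ} → Graph n → ℕ → Set
PathWidthAtMost G k = Σ (PathDecomposition G) (λ D → WidthAtMost D k)

Degree2With : {n : ℕ} → Graph n → Fin n → Fin n → Fin n → Set
Degree2With G u v₁ v₂ =
  vert G u ≡ true × (v₁ ≡ v₂ → ⊥) ×
  adj G u v₁ ≡ true × adj G u v₂ ≡ true ×
  (∀ w → adj G u w ≡ true → (w ≡ v₁) ⊎ (w ≡ v₂))

-- The bags of a width-k path decomposition of H = G/uv₁/uv₂ that contain the merged vertex u
-- form an interval B, C₁, …, Cₘ; the bags outside it are kept.  A bag Cᵢ sharing more than k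
-- vertices with B lies inside B and is discarded.  If some Cᵢ shares at most k vertices with B,
-- take the first one: B and the bags from Cᵢ on are replaced by {v₁, v₂} ∪ (bag ∖ u), of size at
-- most k + 2 since u was in the bag, and the bag {v₁, v₂} ∪ (B ∩ Cᵢ), which contains u, is
-- inserted after the replacement of B.  Otherwise the interval becomes {v₁} ∪ B, {v₂} ∪ B.
-- Every edge of G at v₁ or v₂ other than uv₁, uv₂ comes from an edge at u in H (v₁v₂ is not an
-- edge), and for any other vertex the sequence of bags containing it changes only by deletions
-- and repetitions, which keeps it contiguous.

module Submission where

open import Defs
open import Data.Nat using (ℕ; suc; _≤_; _<_; z≤n; s≤s; _≤?_)
open import Data.Nat.Properties using (≤-trans; m≤n⇒m≤1+n; ≤-pred)
open import Data.Bool using (Bool; true; false; _∧_)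
open import Data.Bool.Properties using (not-¬; ¬-not; ∨-zeroʳ)
open import Data.Fin using (Fin; zero; suc) renaming (_≤_ to _≤ᶠ_)
open import Data.Fin.Properties using (_≟_)
open import Data.List using (List; []; _∷_; _++_; length; lookup; map; filter)
open import Data.List.Properties using (filter-notAll; map-∘; map-cong; map-++)
import Data.List.Relation.Unary.Any.Properties as Anyₚ
open import Data.List.Membership.Propositional using (_∈_; _∉_; find; lose)
import Data.List.Membership.DecPropositional as DecMembership
open import Data.List.Relation.Binary.Subset.Propositional using (_⊆_)
open import Data.List.Relation.Binary.Subset.Propositional.Properties using (filter⁺′; ⊆-trans)
open import Data.List.Relation.Unary.All using (All; []; _∷_)
import Data.List.Relation.Unary.All as All
open import Data.List.Relation.Unary.All.Properties using (map⁺; filter⁺; ++⁺)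
open import Data.List.Relation.Unary.Unique.Propositional using (Unique)
open import Data.List.Relation.Unary.AllPairs using (_∷_)
import Data.List.Relation.Unary.Unique.Propositional.Properties as Unique
open import Data.List.Membership.Propositional.Properties using (∈-lookup; ∈-filter⁺; ∈-filter⁻; ∈-++⁺ˡ; ∈-++⁺ʳ; ∈-++⁻; ∈-map⁺)
open import Data.List.Relation.Unary.Any using (Any; here; there)
import Data.List.Relation.Unary.Any as Any
open import Data.Empty using (⊥; ⊥-elim)
open import Data.Unit using (⊤; tt)
open import Data.Product using (∃₂; _×_; _,_; proj₁; proj₂; uncurry; map₁; swap)
open import Data.Sum using (_⊎_; inj₁; inj₂; [_,_]′)
open import Relation.Binary.PropositionalEquality using (_≡_; _≢_; refl; sym; trans; cong; cong₂; subst; subst₂)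
open import Relation.Nullary using (¬_; Dec; yes; no; does; ¬?; contradiction)
open import Relation.Nullary.Decidable using (dec-true; dec-false; does-⇔; isYes≗does; _×-dec_)
open import Function using (_∘_; id; flip)
open import Function.Bundles using (mk⇔)

data Phase : Set where
  before inside after : Phase

-- The automaton recognising false* true* false*, started in the given phase.
ConvexFrom : Phase → List Bool → Set
ConvexFrom _      []           = ⊤
ConvexFrom before (false ∷ bs) = ConvexFrom before bs
ConvexFrom before (true  ∷ bs) = ConvexFrom inside bs
ConvexFrom inside (true  ∷ bs) = ConvexFrom inside bs
ConvexFrom inside (false ∷ bs) = ConvexFrom after bs
ConvexFrom after  (false ∷ bs) = ConvexFrom after bs
ConvexFrom after  (true  ∷ _)  = ⊥

Convex : List Bool → Set
Convex = ConvexFrom before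

after⇒inside : ∀ bs → ConvexFrom after bs → ConvexFrom inside bs
after⇒inside []          _ = tt
after⇒inside (false ∷ _) c = c

inside⇒before : ∀ bs → ConvexFrom inside bs → ConvexFrom before bs
inside⇒before []           _ = tt
inside⇒before (true  ∷ _)  c = c
inside⇒before (false ∷ bs) c = inside⇒before bs (after⇒inside bs c)

convexFrom-tail : ∀ s b bs → ConvexFrom s (b ∷ bs) → ConvexFrom s bs
convexFrom-tail before false _  c = c
convexFrom-tail before true  bs c = inside⇒before bs c
convexFrom-tail inside false bs c = after⇒inside bs c
convexFrom-tail inside true  _  c = c
convexFrom-tail after  false _  c = c

falses⇒convexFrom : ∀ s {bs} → All (_≡ false) bs → ConvexFrom s bs
falses⇒convexFrom _      []         = tt
falses⇒convexFrom before (refl ∷ f) = falses⇒convexFrom before f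
falses⇒convexFrom inside (refl ∷ f) = falses⇒convexFrom after f
falses⇒convexFrom after  (refl ∷ f) = falses⇒convexFrom after f

trues⇒inside : ∀ {bs} → All (_≡ true) bs → ConvexFrom inside bs
trues⇒inside []         = tt
trues⇒inside (refl ∷ t) = trues⇒inside t

trues⇒convex : ∀ {bs} → All (_≡ true) bs → Convex bs
trues⇒convex []         = tt
trues⇒convex (refl ∷ t) = trues⇒inside t

false∷true∷falses⇒convex : ∀ {a b bs} → a ≡ false → b ≡ true → All (_≡ false) bs →
                           Convex (a ∷ b ∷ bs)
false∷true∷falses⇒convex refl refl f = falses⇒convexFrom inside f

convexFrom-++-falses : ∀ s bs {cs} → ConvexFrom s bs → All (_≡ false) cs →
                       ConvexFrom s (bs ++ cs)
convexFrom-++-falses s      []           _ f = falses⇒convexFrom s f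
convexFrom-++-falses before (false ∷ bs) c f = convexFrom-++-falses before bs c f
convexFrom-++-falses before (true  ∷ bs) c f = convexFrom-++-falses inside bs c f
convexFrom-++-falses inside (true  ∷ bs) c f = convexFrom-++-falses inside bs c f
convexFrom-++-falses inside (false ∷ bs) c f = convexFrom-++-falses after bs c f
convexFrom-++-falses after  (false ∷ bs) c f = convexFrom-++-falses after bs c f

falses-++-convex : ∀ {bs cs} → All (_≡ false) bs → Convex cs → Convex (bs ++ cs)
falses-++-convex []         c = c
falses-++-convex (refl ∷ f) c = falses-++-convex f c

convex-pair : ∀ a b → Convex (a ∷ b ∷ [])
convex-pair false false = tt
convex-pair false true  = tt
convex-pair true  false = tt
convex-pair true  true  = tt

-- ys arises from xs by deleting entries and repeating entries in place.
data Stutter {A : Set} : List A → List A → Set where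
  []   : Stutter [] []
  skip : ∀ {x xs ys} → Stutter xs ys → Stutter (x ∷ xs) ys
  copy : ∀ {x xs ys} → Stutter (x ∷ xs) ys → Stutter (x ∷ xs) (x ∷ ys)

stutter-refl : ∀ {A : Set} (xs : List A) → Stutter xs xs
stutter-refl []       = []
stutter-refl (x ∷ xs) = copy (skip (stutter-refl xs))

stutter-++ : ∀ {A : Set} {xs ys xs′ ys′ : List A} →
             Stutter xs ys → Stutter xs′ ys′ → Stutter (xs ++ xs′) (ys ++ ys′)
stutter-++ []       s′ = s′
stutter-++ (skip s) s′ = skip (stutter-++ s s′)
stutter-++ (copy s) s′ = copy (stutter-++ s s′)

stutter-skip-second : ∀ {A : Set} {x y : A} {xs ys} →
                      Stutter (x ∷ xs) ys → Stutter (x ∷ y ∷ xs) ys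
stutter-skip-second (skip s) = skip (skip s)
stutter-skip-second (copy s) = copy (stutter-skip-second s)

stutter-∧ : ∀ a c {bs cs} → Stutter bs cs → Stutter (a ∷ c ∷ bs) (a ∷ a ∧ c ∷ c ∷ cs)
stutter-∧ true  _ s = copy (skip (copy (copy (skip s))))
stutter-∧ false _ s = copy (copy (skip (copy (skip s))))

convexFrom-stutter : ∀ {bs cs} → Stutter bs cs → ∀ s → ConvexFrom s bs → ConvexFrom s cs
convexFrom-stutter []                _      c = c
convexFrom-stutter (skip {b} {bs} t) s      c = convexFrom-stutter t s (convexFrom-tail s b bs c)
convexFrom-stutter (copy {false} t)  before c = convexFrom-stutter t before c
convexFrom-stutter (copy {true}  t)  before c = convexFrom-stutter t inside c
convexFrom-stutter (copy {true}  t)  inside c = convexFrom-stutter t inside c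
convexFrom-stutter (copy {false} t)  inside c = convexFrom-stutter t after c
convexFrom-stutter (copy {false} t)  after  c = convexFrom-stutter t after c

map-++₃ : ∀ {A B : Set} (f : A → B) xs ys zs → map f (xs ++ ys ++ zs) ≡ map f xs ++ map f ys ++ map f zs
map-++₃ f xs ys zs = trans (map-++ f xs (ys ++ zs)) (cong (map f xs ++_) (map-++ f ys zs))

module _ {A : Set} (p : A → Bool) where

  Contiguous : List A → Set
  Contiguous xs = ∀ (i j k : Fin (length xs)) → i ≤ᶠ j → j ≤ᶠ k →
                  p (lookup xs i) ≡ true → p (lookup xs k) ≡ true → p (lookup xs j) ≡ true

  after⇒falses : ∀ xs → ConvexFrom after (map p xs) → All (λ x → p x ≡ false) xs
  after⇒falses []       _ = []
  after⇒falses (x ∷ xs) c with p x in px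
  ... | false = px ∷ after⇒falses xs c

  falses⇒after : ∀ {xs} → All (λ x → p x ≡ false) xs → ConvexFrom after (map p xs)
  falses⇒after []          = tt
  falses⇒after (px ∷ pxs) rewrite px = falses⇒after pxs

  indexed-falses : ∀ xs → (∀ i → p (lookup xs i) ≡ false) → All (λ x → p x ≡ false) xs
  indexed-falses []       _ = []
  indexed-falses (x ∷ xs) f = f zero ∷ indexed-falses xs (λ i → f (suc i))

  inside⇒downward : ∀ xs → ConvexFrom inside (map p xs) → ∀ (j k : Fin (length xs)) →
                    j ≤ᶠ k → p (lookup xs k) ≡ true → p (lookup xs j) ≡ true
  inside⇒downward (x ∷ xs) c j k j≤k pk with p x in px
  inside⇒downward (x ∷ xs) c zero    _       _         _  | true  = px
  inside⇒downward (x ∷ xs) c (suc j) (suc k) (s≤s j≤k) pk | true  = inside⇒downward xs c j k j≤k pk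
  inside⇒downward (x ∷ xs) c _       zero    _         pk | false = contradiction px (not-¬ pk)
  inside⇒downward (x ∷ xs) c _       (suc k) _         pk | false =
    contradiction (All.lookup (after⇒falses xs c) (∈-lookup k)) (not-¬ pk)

  convex⇒contiguous : ∀ xs → Convex (map p xs) → Contiguous xs
  convex⇒contiguous (x ∷ xs) c i j k i≤j j≤k pi pk with p x in px
  convex⇒contiguous (x ∷ xs) c zero    _       _       _         _         pi _  | false =
    contradiction px (not-¬ pi)
  convex⇒contiguous (x ∷ xs) c (suc i) (suc j) (suc k) (s≤s i≤j) (s≤s j≤k) pi pk | false =
    convex⇒contiguous xs c i j k i≤j j≤k pi pk
  convex⇒contiguous (x ∷ xs) c zero    zero    _       _         _         _  _  | true = px
  convex⇒contiguous (x ∷ xs) c zero    (suc j) (suc k) _         (s≤s j≤k) _  pk | true =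
    inside⇒downward xs c j k j≤k pk
  convex⇒contiguous (x ∷ xs) c (suc i) (suc j) (suc k) (s≤s i≤j) (s≤s j≤k) pi pk | true =
    convex⇒contiguous xs (inside⇒before (map p xs) c) i j k i≤j j≤k pi pk

  downward⇒inside : ∀ xs → (∀ (j k : Fin (length xs)) → j ≤ᶠ k →
                    p (lookup xs k) ≡ true → p (lookup xs j) ≡ true) →
                    ConvexFrom inside (map p xs)
  downward⇒inside []       _ = tt
  downward⇒inside (x ∷ xs) d with p x in px
  ... | true  = downward⇒inside xs (λ j k j≤k → d (suc j) (suc k) (s≤s j≤k))
  ... | false = falses⇒after (indexed-falses xs λ i →
                  ¬-not λ pi → contradiction px (not-¬ (d zero (suc i) z≤n pi)))

  contiguous⇒convex : ∀ xs → Contiguous xs → Convex (map p xs)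
  contiguous⇒convex []       _ = tt
  contiguous⇒convex (x ∷ xs) h with p x in px
  ... | false = contiguous⇒convex xs λ i j k i≤j j≤k → h (suc i) (suc j) (suc k) (s≤s i≤j) (s≤s j≤k)
  ... | true  = downward⇒inside xs λ j k j≤k → h zero (suc j) (suc k) z≤n (s≤s j≤k) px

  record Run (xs : List A) : Set where
    constructor run
    field
      prefix       : List A
      first        : A
      middle       : List A
      suffix       : List A
      split        : xs ≡ prefix ++ first ∷ middle ++ suffix
      prefix-false : All (λ x → p x ≡ false) prefix
      first-true   : p first ≡ true
      middle-true  : All (λ x → p x ≡ true) middle
      suffix-false : All (λ x → p x ≡ false) suffix

  inside⇒span : ∀ xs → ConvexFrom inside (map p xs) →
                ∃₂ λ middle suffix → xs ≡ middle ++ suffix ×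
                  All (λ x → p x ≡ true) middle × All (λ x → p x ≡ false) suffix
  inside⇒span []       _ = [] , [] , refl , [] , []
  inside⇒span (x ∷ xs) c with p x in px
  ... | true  = let middle , suffix , eq , ts , fs = inside⇒span xs c
                in x ∷ middle , suffix , cong (x ∷_) eq , px ∷ ts , fs
  ... | false = [] , x ∷ xs , refl , [] , px ∷ after⇒falses xs c

  convex⇒run : ∀ xs → Convex (map p xs) → Any (λ x → p x ≡ true) xs → Run xs
  convex⇒run (x ∷ xs) c any with p x in px | any
  ... | true  | _ = let middle , suffix , eq , ts , fs = inside⇒span xs c
                    in run [] x middle suffix (cong (x ∷_) eq) [] px ts fs
  ... | false | here px′   = contradiction px (not-¬ px′)
  ... | false | there any′ with convex⇒run xs c any′
  ... | run prefix first middle suffix eq fs t ts fs′ =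
    run (x ∷ prefix) first middle suffix (cong (x ∷_) eq) (px ∷ fs) t ts fs′

module _ {n : ℕ} where

  infix 4 _∈?_
  infix 4.5 _∈ᵇ_
  infixl 6 _∖_
  infixl 7 _∩_

  _∈?_ : (x : Fin n) (D : List (Fin n)) → Dec (x ∈ D)
  _∈?_ = DecMembership._∈?_ _≟_

  _∈ᵇ_ : Fin n → List (Fin n) → Bool
  x ∈ᵇ D = does (x ∈? D)

  ∈⇒∈ᵇ : ∀ {x D} → x ∈ D → x ∈ᵇ D ≡ true
  ∈⇒∈ᵇ {x} {D} = dec-true (x ∈? D)

  ∉⇒∈ᵇ : ∀ {x D} → x ∉ D → x ∈ᵇ D ≡ false
  ∉⇒∈ᵇ {x} {D} = dec-false (x ∈? D)

  ∈ᵇ⇒∈ : ∀ {x D} → x ∈ᵇ D ≡ true → x ∈ D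
  ∈ᵇ⇒∈ {x} {D} e with x ∈? D
  ... | yes x∈D = x∈D
  ... | no  _   = contradiction e λ ()

  ∈ᵇ-false⇒∉ : ∀ {x D} → x ∈ᵇ D ≡ false → x ∉ D
  ∈ᵇ-false⇒∉ e x∈D = not-¬ (∈⇒∈ᵇ x∈D) e

  ∈ᵇ-cong : ∀ {x} D E → (x ∈ D → x ∈ E) → (x ∈ E → x ∈ D) → x ∈ᵇ D ≡ x ∈ᵇ E
  ∈ᵇ-cong {x} D E to from = does-⇔ (mk⇔ to from) (x ∈? D) (x ∈? E)

  _∖_ : List (Fin n) → Fin n → List (Fin n)
  D ∖ y = filter (λ x → ¬? (x ≟ y)) D

  _∩_ : List (Fin n) → List (Fin n) → List (Fin n)
  B ∩ C = filter (_∈? B) C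

  ∈-∖⁺ : ∀ {x y D} → x ∈ D → x ≢ y → x ∈ D ∖ y
  ∈-∖⁺ {y = y} = ∈-filter⁺ (λ x → ¬? (x ≟ y))

  ∈-∖⁻ : ∀ {x y D} → x ∈ D ∖ y → x ∈ D × x ≢ y
  ∈-∖⁻ {y = y} = ∈-filter⁻ (λ x → ¬? (x ≟ y))

  ∖-mono : ∀ {y D E} → D ⊆ E → D ∖ y ⊆ E ∖ y
  ∖-mono {y} = filter⁺′ P? P? id where P? = λ x → ¬? (x ≟ y)

  length-∖ : ∀ {y D} → y ∈ D → length (D ∖ y) < length D
  length-∖ {y} {D} y∈D = filter-notAll (λ x → ¬? (x ≟ y)) D (Any.map (λ { refl y≢y → y≢y refl }) y∈D)

  ∈-∩⁺ : ∀ {x B C} → x ∈ B → x ∈ C → x ∈ B ∩ C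
  ∈-∩⁺ {B = B} x∈B x∈C = ∈-filter⁺ (_∈? B) x∈C x∈B

  ∈-∩⁻ : ∀ {x B C} → x ∈ B ∩ C → x ∈ B × x ∈ C
  ∈-∩⁻ {B = B} x∈B∩C = let x∈C , x∈B = ∈-filter⁻ (_∈? B) x∈B∩C in x∈B , x∈C

  ∖-⊆ : ∀ {y D} → D ∖ y ⊆ D
  ∖-⊆ = proj₁ ∘ ∈-∖⁻

  ∈ᵇ-++-fresh : ∀ {x} S {D} → x ∉ S → x ∈ᵇ S ++ D ≡ x ∈ᵇ D
  ∈ᵇ-++-fresh S {D} x∉S = ∈ᵇ-cong (S ++ D) D ([ flip contradiction x∉S , id ]′ ∘ ∈-++⁻ S) (∈-++⁺ʳ S)

  ∈ᵇ-∖ : ∀ {x y} D → x ≢ y → x ∈ᵇ D ∖ y ≡ x ∈ᵇ D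
  ∈ᵇ-∖ {y = y} D x≢y = ∈ᵇ-cong (D ∖ y) D ∖-⊆ (λ x∈D → ∈-∖⁺ x∈D x≢y)

  ∈ᵇ-∩ : ∀ {x} B C → x ∈ᵇ B ∩ C ≡ (x ∈ᵇ B) ∧ (x ∈ᵇ C)
  ∈ᵇ-∩ {x} B C = does-⇔ (mk⇔ ∈-∩⁻ (uncurry ∈-∩⁺)) (x ∈? B ∩ C) (x ∈? B ×-dec x ∈? C)

  decomposition-convex : {G : Graph n} (D : PathDecomposition G) (x : Fin n) →
                         Convex (map (x ∈ᵇ_) (bags D))
  decomposition-convex D x = contiguous⇒convex (x ∈ᵇ_) (bags D) λ i j k i≤j j≤k xi xk →
    ∈⇒∈ᵇ (contiguous D i j k x i≤j j≤k (∈ᵇ⇒∈ xi) (∈ᵇ⇒∈ xk))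

  convex⇒contiguous-bags : (bs : List (List (Fin n))) → (∀ x → Convex (map (x ∈ᵇ_) bs)) →
    ∀ (i j k : Fin (length bs)) (x : Fin n) → i ≤ᶠ j → j ≤ᶠ k →
    x ∈ lookup bs i → x ∈ lookup bs k → x ∈ lookup bs j
  convex⇒contiguous-bags bs c i j k x i≤j j≤k xi xk =
    ∈ᵇ⇒∈ (convex⇒contiguous (x ∈ᵇ_) bs (c x) i j k i≤j j≤k (∈⇒∈ᵇ xi) (∈⇒∈ᵇ xk))

  ==-refl : ∀ (x : Fin n) → x == x ≡ true
  ==-refl x = trans (isYes≗does (x ≟ x)) (dec-true (x ≟ x) refl)

  ==-false : ∀ {x y : Fin n} → x ≢ y → x == y ≡ false
  ==-false {x} {y} = trans (isYes≗does (x ≟ y)) ∘ dec-false (x ≟ y)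

  module _ (G : Graph n) (x y : Fin n) where

    /-vert⁻ : ∀ {w} → vert (G / x ─ y) w ≡ true → vert G w ≡ true × w ≢ y
    /-vert⁻ {w} e with vert G w | w ≟ y
    ... | true  | no w≢y = refl , w≢y
    ... | true  | yes _  = contradiction e λ ()
    ... | false | _      = contradiction e λ ()

    /-vert⁺ : ∀ {w} → vert G w ≡ true → w ≢ y → vert (G / x ─ y) w ≡ true
    /-vert⁺ e w≢y rewrite e | ==-false w≢y = refl

    /-adj⁺ : ∀ {a b} → a ≢ y → b ≢ y → a ≢ b → adj G a b ≡ true → adj (G / x ─ y) a b ≡ true
    /-adj⁺ a≢y b≢y a≢b e rewrite ==-false a≢y | ==-false b≢y | ==-false a≢b | e = refl

    /-adj-merged⁺ : ∀ {b} → x ≢ y → b ≢ y → x ≢ b → adj G y b ≡ true →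
                    adj (G / x ─ y) x b ≡ true
    /-adj-merged⁺ {b} x≢y b≢y x≢b e
      rewrite ==-false x≢y | ==-false b≢y | ==-false x≢b | ==-refl x | e = ∨-zeroʳ (adj G x b)

module RunExpansion {n : ℕ} (k : ℕ) (u v₁ v₂ : Fin n)
                    (u≢v₁ : u ≢ v₁) (u≢v₂ : u ≢ v₂) (v₁≢v₂ : v₁ ≢ v₂) where

  Bag : Set
  Bag = List (Fin n)

  ends : Bag
  ends = v₁ ∷ v₂ ∷ []

  expand : Bag → Bag
  expand D = ends ++ D ∖ u

  junction : Bag → Bag → Bag
  junction B C = ends ++ B ∩ C

  expandRun : Bag → List Bag → List Bag
  expandRun B []       = (v₁ ∷ B) ∷ (v₂ ∷ B) ∷ []
  expandRun B (C ∷ Cs) with length (B ∩ C) ≤? k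
  ... | yes _ = expand B ∷ junction B C ∷ map expand (C ∷ Cs)
  ... | no  _ = expandRun B Cs

  record RunBag (D : Bag) : Set where
    field
      ∋u       : u ∈ D
      narrow   : length D ≤ suc k
      unique   : Unique D
      disjoint : ∀ {x} → x ∈ D → x ∉ ends
  open RunBag

  large-overlap⇒⊆ : ∀ {B C : Bag} → length C ≤ suc k → ¬ length (B ∩ C) ≤ k → C ⊆ B
  large-overlap⇒⊆ {B} {C} narrowC large {x} x∈C with x ∈? B
  ... | yes x∈B = x∈B
  ... | no  x∉B = contradiction (≤-pred (≤-trans (filter-notAll (_∈? B) C (lose x∈C x∉B)) narrowC)) large

  expand-narrow : ∀ {D} → RunBag D → length (expand D) ≤ suc (suc k)
  expand-narrow d = s≤s (s≤s (≤-pred (≤-trans (length-∖ (∋u d)) (narrow d))))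

  expandRun-narrow : ∀ {B} Cs → RunBag B → All RunBag Cs →
                     All (λ D → length D ≤ suc (suc k)) (expandRun B Cs)
  expandRun-narrow     []       b _        = s≤s (narrow b) ∷ s≤s (narrow b) ∷ []
  expandRun-narrow {B} (C ∷ Cs) b (c ∷ cs) with length (B ∩ C) ≤? k
  ... | yes small = expand-narrow b ∷ s≤s (s≤s small) ∷ map⁺ (All.map expand-narrow (c ∷ cs))
  ... | no  _     = expandRun-narrow Cs b cs

  ends-fresh : ∀ {S v} → (∀ {x} → x ∈ S → x ∉ ends) → v ∈ ends → All (v ≢_) S
  ends-fresh fresh v∈ends = All.tabulate λ { x∈S refl → fresh x∈S v∈ends }

  ends-++-unique : ∀ {S} → (∀ {x} → x ∈ S → x ∉ ends) → Unique S → Unique (ends ++ S)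
  ends-++-unique fresh uniqueS =
    (v₁≢v₂ ∷ ends-fresh fresh (here refl)) ∷ ends-fresh fresh (there (here refl)) ∷ uniqueS

  expand-unique : ∀ {D} → RunBag D → Unique (expand D)
  expand-unique d = ends-++-unique (disjoint d ∘ ∖-⊆) (Unique.filter⁺ _ (unique d))

  expandRun-unique : ∀ {B} Cs → RunBag B → All RunBag Cs → All Unique (expandRun B Cs)
  expandRun-unique [] b _ =
    (ends-fresh (disjoint b) (here refl) ∷ unique b) ∷
    (ends-fresh (disjoint b) (there (here refl)) ∷ unique b) ∷ []
  expandRun-unique {B} (C ∷ Cs) b (c ∷ cs) with length (B ∩ C) ≤? k
  ... | yes _ = expand-unique b
              ∷ ends-++-unique (disjoint c ∘ proj₂ ∘ ∈-∩⁻) (Unique.filter⁺ _ (unique c))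
              ∷ map⁺ (All.map expand-unique (c ∷ cs))
  ... | no  _ = expandRun-unique Cs b cs

  expand-All : ∀ {P : Fin n → Set} {D} → All P ends → All P D → All P (expand D)
  expand-All pends pD = ++⁺ pends (filter⁺ _ pD)

  expandRun-All : ∀ {P : Fin n → Set} → All P ends → ∀ {B} Cs → All P B → All (All P) Cs →
                  All (All P) (expandRun B Cs)
  expandRun-All (p₁ ∷ p₂ ∷ []) [] pB _ = (p₁ ∷ pB) ∷ (p₂ ∷ pB) ∷ []
  expandRun-All pends {B} (C ∷ Cs) pB (pC ∷ pCs) with length (B ∩ C) ≤? k
  ... | yes _ = expand-All pends pB ∷ ++⁺ pends (filter⁺ _ pC) ∷ map⁺ (All.map (expand-All pends) (pC ∷ pCs))
  ... | no  _ = expandRun-All pends Cs pB pCs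

  expandRun-∋u : ∀ {v} → v ∈ ends → ∀ {B} Cs → u ∈ B → All (u ∈_) Cs →
                 Any (λ D → u ∈ D × v ∈ D) (expandRun B Cs)
  expandRun-∋u (here refl)         [] u∈B _ = here (there u∈B , here refl)
  expandRun-∋u (there (here refl)) [] u∈B _ = there (here (there u∈B , here refl))
  expandRun-∋u v∈ends {B} (C ∷ Cs) u∈B (u∈C ∷ u∈Cs) with length (B ∩ C) ≤? k
  ... | yes _ = there (here (∈-++⁺ʳ ends (∈-∩⁺ u∈B u∈C) , ∈-++⁺ˡ v∈ends))
  ... | no  _ = expandRun-∋u v∈ends Cs u∈B u∈Cs

  expand-covers : ∀ {v} → v ∈ ends → ∀ D → D ∖ u ⊆ expand D × v ∈ expand D
  expand-covers v∈ends D = ∈-++⁺ʳ ends , ∈-++⁺ˡ v∈ends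

  expandRun-covers : ∀ {v} → v ∈ ends → ∀ {B} Cs → All (λ C → length C ≤ suc k) Cs →
                     ∀ {D} → D ∈ B ∷ Cs → Any (λ D′ → D ∖ u ⊆ D′ × v ∈ D′) (expandRun B Cs)
  expandRun-covers (here refl)         [] _ (here refl) = here (there ∘ ∖-⊆ , here refl)
  expandRun-covers (there (here refl)) [] _ (here refl) = there (here (there ∘ ∖-⊆ , here refl))
  expandRun-covers v∈ends {B} (C ∷ Cs) (narrowC ∷ narrowCs) {D} D∈ with length (B ∩ C) ≤? k | D∈
  ... | yes _ | here refl = here (expand-covers v∈ends B)
  ... | yes _ | there D∈′ = there (there (lose (∈-map⁺ expand D∈′) (expand-covers v∈ends D)))
  ... | no  _     | here refl         = expandRun-covers v∈ends Cs narrowCs (here refl)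
  ... | no  large | there (here refl) =
    Any.map (map₁ (⊆-trans (∖-mono {y = u} (large-overlap⇒⊆ {B} {C} narrowC large))))
            (expandRun-covers v∈ends Cs narrowCs (here refl))
  ... | no  _     | there (there D∈′) = expandRun-covers v∈ends Cs narrowCs (there D∈′)

  module _ {x} (x≢u : x ≢ u) (x∉ends : x ∉ ends) where

    ∈ᵇ-expand : ∀ D → x ∈ᵇ expand D ≡ x ∈ᵇ D
    ∈ᵇ-expand D = trans (∈ᵇ-++-fresh ends {D ∖ u} x∉ends) (∈ᵇ-∖ D x≢u)

    ∈ᵇ-junction : ∀ B C → x ∈ᵇ junction B C ≡ (x ∈ᵇ B) ∧ (x ∈ᵇ C)
    ∈ᵇ-junction B C = trans (∈ᵇ-++-fresh ends {B ∩ C} x∉ends) (∈ᵇ-∩ B C)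

    ∈ᵇ-map-expand : ∀ Ds → map (x ∈ᵇ_) (map expand Ds) ≡ map (x ∈ᵇ_) Ds
    ∈ᵇ-map-expand Ds = trans (sym (map-∘ Ds)) (map-cong ∈ᵇ-expand Ds)

    expandRun-stutter : ∀ B Cs → Stutter (map (x ∈ᵇ_) (B ∷ Cs)) (map (x ∈ᵇ_) (expandRun B Cs))
    expandRun-stutter B []
      rewrite ∈ᵇ-++-fresh (v₁ ∷ []) {B} (x∉ends ∘ ∈-++⁺ˡ)
            | ∈ᵇ-++-fresh (v₂ ∷ []) {B} (x∉ends ∘ there) = copy (copy (skip []))
    expandRun-stutter B (C ∷ Cs) with length (B ∩ C) ≤? k
    ... | yes _ = subst (Stutter (map (x ∈ᵇ_) (B ∷ C ∷ Cs))) (sym memberships)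
                        (stutter-∧ (x ∈ᵇ B) (x ∈ᵇ C) (stutter-refl _))
      where
      memberships : map (x ∈ᵇ_) (expand B ∷ junction B C ∷ map expand (C ∷ Cs)) ≡
                    (x ∈ᵇ B) ∷ (x ∈ᵇ B) ∧ (x ∈ᵇ C) ∷ map (x ∈ᵇ_) (C ∷ Cs)
      memberships = cong₂ _∷_ (∈ᵇ-expand B) (cong₂ _∷_ (∈ᵇ-junction B C) (∈ᵇ-map-expand (C ∷ Cs)))
    ... | no  _ = stutter-skip-second (expandRun-stutter B Cs)

  u∉ends : u ∉ ends
  u∉ends (here u≡v₁)         = u≢v₁ u≡v₁
  u∉ends (there (here u≡v₂)) = u≢v₂ u≡v₂

  u∉expand : ∀ D → u ∉ expand D
  u∉expand D = [ u∉ends , (λ u∈D∖u → proj₂ (∈-∖⁻ {D = D} u∈D∖u) refl) ]′ ∘ ∈-++⁻ ends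

  expandRun-convex-u : ∀ B Cs → u ∈ B → All (u ∈_) Cs → Convex (map (u ∈ᵇ_) (expandRun B Cs))
  expandRun-convex-u B [] _ _ = convex-pair (u ∈ᵇ v₁ ∷ B) (u ∈ᵇ v₂ ∷ B)
  expandRun-convex-u B (C ∷ Cs) u∈B (u∈C ∷ u∈Cs) with length (B ∩ C) ≤? k
  ... | yes _ = false∷true∷falses⇒convex (u∉ᵇexpand B)
                  (∈⇒∈ᵇ {D = junction B C} (∈-++⁺ʳ ends (∈-∩⁺ u∈B u∈C)))
                  (map⁺ (map⁺ (All.universal u∉ᵇexpand (C ∷ Cs))))
    where
    u∉ᵇexpand : ∀ D → u ∈ᵇ expand D ≡ false
    u∉ᵇexpand D = ∉⇒∈ᵇ (u∉expand D)
  ... | no  _ = expandRun-convex-u B Cs u∈B u∈Cs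

  ∈ᵇ-ends-++ : ∀ {v} → v ∈ ends → ∀ S → v ∈ᵇ ends ++ S ≡ true
  ∈ᵇ-ends-++ v∈ends S = ∈⇒∈ᵇ {D = ends ++ S} (∈-++⁺ˡ v∈ends)

  expandRun-convex-end : ∀ {v} → v ∈ ends → ∀ B Cs → Convex (map (v ∈ᵇ_) (expandRun B Cs))
  expandRun-convex-end {v} _ B [] = convex-pair (v ∈ᵇ v₁ ∷ B) (v ∈ᵇ v₂ ∷ B)
  expandRun-convex-end v∈ends B (C ∷ Cs) with length (B ∩ C) ≤? k
  ... | yes _ = trues⇒convex (∈ᵇ-ends-++ v∈ends (B ∖ u) ∷ ∈ᵇ-ends-++ v∈ends (B ∩ C) ∷
                               map⁺ (map⁺ (All.universal (∈ᵇ-ends-++ v∈ends ∘ (_∖ u)) (C ∷ Cs))))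
  ... | no  _ = expandRun-convex-end v∈ends B Cs

module ExpandedDecomposition {n : ℕ} (G : Graph n) (simple : Simple G) (u v₁ v₂ : Fin n)
                 (u∈V : vert G u ≡ true) (v₁≢v₂ : v₁ ≢ v₂)
                 (u∼v₁ : adj G u v₁ ≡ true) (u∼v₂ : adj G u v₂ ≡ true)
                 (N[u] : ∀ w → adj G u w ≡ true → (w ≡ v₁) ⊎ (w ≡ v₂))
                 (v₁≁v₂ : adj G v₁ v₂ ≡ false)
                 (k : ℕ) (D : PathDecomposition ((G / u ─ v₁) / u ─ v₂)) (width : WidthAtMost D k) where

  open Simple simple

  H : Graph n
  H = (G / u ─ v₁) / u ─ v₂

  adj⇒≢ : ∀ {a b} → adj G a b ≡ true → a ≢ b
  adj⇒≢ {a} a∼a refl = not-¬ a∼a (adj-irrefl a)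

  u≢v₁ : u ≢ v₁
  u≢v₁ = adj⇒≢ u∼v₁

  u≢v₂ : u ≢ v₂
  u≢v₂ = adj⇒≢ u∼v₂

  open RunExpansion k u v₁ v₂ u≢v₁ u≢v₂ v₁≢v₂

  vert-H⁻ : ∀ {w} → vert H w ≡ true → vert G w ≡ true × w ∉ ends
  vert-H⁻ w∈V[H] =
    let w∈V[G/uv₁] , w≢v₂ = /-vert⁻ (G / u ─ v₁) u v₂ w∈V[H]
        w∈V[G] , w≢v₁ = /-vert⁻ G u v₁ w∈V[G/uv₁]
    in w∈V[G] , λ { (here w≡v₁) → w≢v₁ w≡v₁ ; (there (here w≡v₂)) → w≢v₂ w≡v₂ }

  vert-H⁺ : ∀ {w} → vert G w ≡ true → w ∉ ends → vert H w ≡ true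
  vert-H⁺ w∈V w∉ends =
    /-vert⁺ (G / u ─ v₁) u v₂ (/-vert⁺ G u v₁ w∈V (w∉ends ∘ here)) (w∉ends ∘ there ∘ here)

  adj-H⁺ : ∀ {a b} → a ∉ ends → b ∉ ends → adj G a b ≡ true → adj H a b ≡ true
  adj-H⁺ a∉ends b∉ends a∼b =
    /-adj⁺ (G / u ─ v₁) u v₂ (a∉ends ∘ there ∘ here) (b∉ends ∘ there ∘ here) (adj⇒≢ a∼b)
      (/-adj⁺ G u v₁ (a∉ends ∘ here) (b∉ends ∘ here) (adj⇒≢ a∼b) a∼b)

  adj-H-centre⁺ : ∀ {a b} → a ∈ ends → b ≢ u → b ∉ ends → adj G a b ≡ true → adj H u b ≡ true
  adj-H-centre⁺ (here refl) b≢u b∉ends v₁∼b =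
    /-adj⁺ (G / u ─ v₁) u v₂ u≢v₂ (b∉ends ∘ there ∘ here) (b≢u ∘ sym)
      (/-adj-merged⁺ G u v₁ u≢v₁ (b∉ends ∘ here) (b≢u ∘ sym) v₁∼b)
  adj-H-centre⁺ (there (here refl)) b≢u b∉ends v₂∼b =
    /-adj-merged⁺ (G / u ─ v₁) u v₂ u≢v₂ (b∉ends ∘ there ∘ here) (b≢u ∘ sym)
      (/-adj⁺ G u v₁ (v₁≢v₂ ∘ sym) (b∉ends ∘ here) (adj⇒≢ v₂∼b) v₂∼b)

  ends-independent : ∀ {a b} → a ∈ ends → b ∈ ends → adj G a b ≡ true → ⊥
  ends-independent (here refl)         (here refl)         v₁∼v₁ = adj⇒≢ v₁∼v₁ refl
  ends-independent (here refl)         (there (here refl)) v₁∼v₂ = not-¬ v₁∼v₂ v₁≁v₂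
  ends-independent (there (here refl)) (here refl)         v₂∼v₁ = not-¬ (adj-sym v₂ v₁ v₂∼v₁) v₁≁v₂
  ends-independent (there (here refl)) (there (here refl)) v₂∼v₂ = adj⇒≢ v₂∼v₂ refl

  N[u]⊆ends : ∀ {w} → adj G u w ≡ true → w ∈ ends
  N[u]⊆ends {w} u∼w = [ here , there ∘ here ]′ (N[u] w u∼w)

  data Role (x : Fin n) : Set where
    centre : x ≡ u → Role x
    end    : x ∈ ends → Role x
    other  : x ≢ u → x ∉ ends → Role x

  role : ∀ x → Role x
  role x with x ≟ u | x ∈? ends
  ... | yes x≡u | _          = centre x≡u
  ... | no  _   | yes x∈ends = end x∈ends
  ... | no  x≢u | no  x∉ends = other x≢u x∉ends

  old-vertices : ∀ {B} → B ∈ bags D → ∀ {x} → x ∈ B → vert G x ≡ true × x ∉ ends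
  old-vertices B∈ x∈B = vert-H⁻ (All.lookup (All.lookup (bags-vert D) B∈) x∈B)

  old-runBag : ∀ {B} → B ∈ bags D → u ∈ B → RunBag B
  old-runBag B∈ u∈B = record
    { ∋u       = u∈B
    ; narrow   = All.lookup width B∈
    ; unique   = All.lookup (bags-unique D) B∈
    ; disjoint = proj₂ ∘ old-vertices B∈
    }

  u-run : Run (u ∈ᵇ_) (bags D)
  u-run = convex⇒run (u ∈ᵇ_) (bags D) (decomposition-convex D u)
             (Any.map ∈⇒∈ᵇ (cover-vert D u (vert-H⁺ u∈V u∉ends)))

  open Run u-run

  runBags : List Bag
  runBags = expandRun first middle

  newBags : List Bag
  newBags = prefix ++ runBags ++ suffix

  ∈-bags : ∀ {B} → B ∈ prefix ++ first ∷ middle ++ suffix → B ∈ bags D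
  ∈-bags = subst (_ ∈_) (sym split)

  old-bag : ∀ {B} → B ∈ bags D → (B ∈ newBags × u ∉ B) ⊎ B ∈ first ∷ middle
  old-bag B∈ with ∈-++⁻ prefix (subst (_ ∈_) split B∈)
  ... | inj₁ B∈prefix = inj₁ (∈-++⁺ˡ B∈prefix , ∈ᵇ-false⇒∉ (All.lookup prefix-false B∈prefix))
  ... | inj₂ (here refl) = inj₂ (here refl)
  ... | inj₂ (there B∈rest) with ∈-++⁻ middle B∈rest
  ... | inj₁ B∈middle = inj₂ (there B∈middle)
  ... | inj₂ B∈suffix =
    inj₁ (∈-++⁺ʳ prefix (∈-++⁺ʳ runBags B∈suffix) , ∈ᵇ-false⇒∉ (All.lookup suffix-false B∈suffix))

  prefix⊆bags : ∀ {B} → B ∈ prefix → B ∈ bags D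
  prefix⊆bags = ∈-bags ∘ ∈-++⁺ˡ

  first∈bags : first ∈ bags D
  first∈bags = ∈-bags (∈-++⁺ʳ prefix (here refl))

  middle⊆bags : ∀ {B} → B ∈ middle → B ∈ bags D
  middle⊆bags = ∈-bags ∘ ∈-++⁺ʳ prefix ∘ there ∘ ∈-++⁺ˡ

  suffix⊆bags : ∀ {B} → B ∈ suffix → B ∈ bags D
  suffix⊆bags = ∈-bags ∘ ∈-++⁺ʳ prefix ∘ there ∘ ∈-++⁺ʳ middle

  new-bag : ∀ {B} → B ∈ newBags → B ∈ bags D ⊎ B ∈ runBags
  new-bag B∈ with ∈-++⁻ prefix B∈
  ... | inj₁ B∈prefix = inj₁ (prefix⊆bags B∈prefix)
  ... | inj₂ B∈rest with ∈-++⁻ runBags B∈rest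
  ... | inj₁ B∈run    = inj₂ B∈run
  ... | inj₂ B∈suffix = inj₁ (suffix⊆bags B∈suffix)

  first-runBag : RunBag first
  first-runBag = old-runBag first∈bags (∈ᵇ⇒∈ first-true)

  middle-runBags : All RunBag middle
  middle-runBags = All.tabulate λ C∈ →
    old-runBag (middle⊆bags C∈) (∈ᵇ⇒∈ (All.lookup middle-true C∈))

  middle-narrow : All (λ C → length C ≤ suc k) middle
  middle-narrow = All.map RunBag.narrow middle-runBags

  inRun : ∀ {P : Bag → Set} → Any P runBags → Any P newBags
  inRun = Anyₚ.++⁺ʳ prefix ∘ Anyₚ.++⁺ˡ

  run-∋u : ∀ {v} → v ∈ ends → Any (λ B → u ∈ B × v ∈ B) newBags
  run-∋u v∈ends = inRun (expandRun-∋u v∈ends middle (∈ᵇ⇒∈ first-true) (All.map ∈ᵇ⇒∈ middle-true))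

  run-shadow : ∀ {v B} → v ∈ ends → B ∈ bags D → u ∈ B → Any (λ B′ → B ∖ u ⊆ B′ × v ∈ B′) newBags
  run-shadow v∈ends B∈ u∈B with old-bag B∈
  ... | inj₁ (_ , u∉B) = contradiction u∈B u∉B
  ... | inj₂ B∈run     = inRun (expandRun-covers v∈ends middle middle-narrow B∈run)

  shadow : ∀ {B} → B ∈ bags D → Any (λ B′ → B ∖ u ⊆ B′) newBags
  shadow B∈ with old-bag B∈
  ... | inj₁ (B∈newBags , _) = lose B∈newBags ∖-⊆
  ... | inj₂ B∈run       =
    Any.map proj₁ (inRun (expandRun-covers (here refl) middle middle-narrow B∈run))

  new-cover-vert : ∀ x → vert G x ≡ true → Any (x ∈_) newBags
  new-cover-vert x x∈V with role x
  ... | centre refl      = Any.map proj₁ (run-∋u (here refl))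
  ... | end x∈ends       = Any.map proj₂ (run-∋u x∈ends)
  ... | other x≢u x∉ends =
    let _ , B∈ , x∈B = find (cover-vert D x (vert-H⁺ x∈V x∉ends))
    in Any.map (λ B∖u⊆ → B∖u⊆ (∈-∖⁺ x∈B x≢u)) (shadow B∈)

  cover-end-edge : ∀ {a b} → a ∈ ends → b ≢ u → b ∉ ends → adj G a b ≡ true →
                   Any (λ B → a ∈ B × b ∈ B) newBags
  cover-end-edge a∈ends b≢u b∉ends a∼b =
    let _ , B∈ , u∈B , b∈B = find (cover-edge D u _ (adj-H-centre⁺ a∈ends b≢u b∉ends a∼b))
    in Any.map (λ (B∖u⊆ , a∈) → a∈ , B∖u⊆ (∈-∖⁺ b∈B b≢u)) (run-shadow a∈ends B∈ u∈B)

  cover-other-edge : ∀ {a b} → a ≢ u → a ∉ ends → b ≢ u → b ∉ ends → adj G a b ≡ true →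
               Any (λ B → a ∈ B × b ∈ B) newBags
  cover-other-edge a≢u a∉ends b≢u b∉ends a∼b =
    let _ , B∈ , a∈B , b∈B = find (cover-edge D _ _ (adj-H⁺ a∉ends b∉ends a∼b))
    in Any.map (λ B∖u⊆ → B∖u⊆ (∈-∖⁺ a∈B a≢u) , B∖u⊆ (∈-∖⁺ b∈B b≢u)) (shadow B∈)

  new-cover-edge : ∀ a b → adj G a b ≡ true → Any (λ B → a ∈ B × b ∈ B) newBags
  new-cover-edge a b a∼b with role a | role b
  ... | centre refl | _           = run-∋u (N[u]⊆ends a∼b)
  ... | _           | centre refl = Any.map swap (run-∋u (N[u]⊆ends (adj-sym a u a∼b)))
  ... | end a∈ | end b∈           = ⊥-elim (ends-independent a∈ b∈ a∼b)
  ... | end a∈ | other b≢u b∉     = cover-end-edge a∈ b≢u b∉ a∼b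
  ... | other a≢u a∉ | end b∈     = Any.map swap (cover-end-edge b∈ a≢u a∉ (adj-sym a b a∼b))
  ... | other a≢u a∉ | other b≢u b∉ = cover-other-edge a≢u a∉ b≢u b∉ a∼b

  end∉old : ∀ {v B} → v ∈ ends → B ∈ bags D → v ∈ᵇ B ≡ false
  end∉old v∈ends B∈ = ∉⇒∈ᵇ λ v∈B → proj₂ (old-vertices B∈ v∈B) v∈ends

  sandwich : ∀ {x} → All (λ B → x ∈ᵇ B ≡ false) prefix → All (λ B → x ∈ᵇ B ≡ false) suffix →
             Convex (map (x ∈ᵇ_) runBags) → Convex (map (x ∈ᵇ_) newBags)
  sandwich {x} outside₁ outside₂ c = subst Convex (sym (map-++₃ (x ∈ᵇ_) prefix runBags suffix))
    (falses-++-convex (map⁺ outside₁) (convexFrom-++-falses before (map (x ∈ᵇ_) runBags) c (map⁺ outside₂)))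

  old⇝new : ∀ {x} → x ≢ u → x ∉ ends → Stutter (map (x ∈ᵇ_) (bags D)) (map (x ∈ᵇ_) newBags)
  old⇝new {x} x≢u x∉ends =
    subst₂ Stutter (sym (trans (cong (map (x ∈ᵇ_)) split) (map-++₃ (x ∈ᵇ_) prefix (first ∷ middle) suffix)))
                   (sym (map-++₃ (x ∈ᵇ_) prefix runBags suffix))
      (stutter-++ (stutter-refl _) (stutter-++ (expandRun-stutter x≢u x∉ends first middle) (stutter-refl _)))

  new-convex : ∀ x → Convex (map (x ∈ᵇ_) newBags)
  new-convex x with role x
  ... | centre refl = sandwich prefix-false suffix-false
                        (expandRun-convex-u first middle (∈ᵇ⇒∈ first-true) (All.map ∈ᵇ⇒∈ middle-true))
  ... | end x∈ends = sandwich (All.tabulate (end∉old x∈ends ∘ prefix⊆bags))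
                              (All.tabulate (end∉old x∈ends ∘ suffix⊆bags))
                              (expandRun-convex-end x∈ends first middle)
  ... | other x≢u x∉ends = convexFrom-stutter (old⇝new x≢u x∉ends) before (decomposition-convex D x)

  new-narrow : All (λ B → length B ≤ suc (suc k)) newBags
  new-narrow = All.tabulate λ B∈ → [ m≤n⇒m≤1+n ∘ All.lookup width
                                   , All.lookup (expandRun-narrow middle first-runBag middle-runBags) ]′ (new-bag B∈)

  new-unique : All Unique newBags
  new-unique = All.tabulate λ B∈ → [ All.lookup (bags-unique D)
                                   , All.lookup (expandRun-unique middle first-runBag middle-runBags) ]′ (new-bag B∈)

  new-vert : All (All (λ x → vert G x ≡ true)) newBags
  new-vert = All.tabulate λ B∈ → [ old-vert , All.lookup run-vert ]′ (new-bag B∈)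
    where
    old-vert : ∀ {B} → B ∈ bags D → All (λ x → vert G x ≡ true) B
    old-vert B∈ = All.tabulate (proj₁ ∘ old-vertices B∈)
    run-vert : All (All (λ x → vert G x ≡ true)) runBags
    run-vert = expandRun-All (adj-vertˡ v₁ u (adj-sym u v₁ u∼v₁) ∷ adj-vertˡ v₂ u (adj-sym u v₂ u∼v₂) ∷ [])
                 middle
                 (old-vert first∈bags) (All.tabulate (old-vert ∘ middle⊆bags))

  decomposition : PathDecomposition G
  decomposition = record
    { bags        = newBags
    ; bags-unique = new-unique
    ; bags-vert   = new-vert
    ; cover-vert  = new-cover-vert
    ; cover-edge  = new-cover-edge
    ; contiguous  = convex⇒contiguous-bags newBags new-convex
    }

lemma3p5 : {n : ℕ} (G : Graph n) → Simple G → (u v₁ v₂ : Fin n) →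
           Degree2With G u v₁ v₂ → adj G v₁ v₂ ≡ false →
           ∀ (k : ℕ) → PathWidthAtMost ((G / u ─ v₁) / u ─ v₂) k →
           PathWidthAtMost G (suc k)
lemma3p5 G simple u v₁ v₂ (u∈V , v₁≢v₂ , u∼v₁ , u∼v₂ , N[u]) v₁≁v₂ k (D , width) =
  decomposition , new-narrow
  where open ExpandedDecomposition G simple u v₁ v₂ u∈V v₁≢v₂ u∼v₁ u∼v₂ N[u] v₁≁v₂ k D width
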